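{- For every $n\ge 3$, player $\mathcal{B}$ has a symmetric strategy in the avoidance game $(K_n,P_2)$; that is, $\mathcal{B}$ has a strategy such that, independently of $\mathcal{A}$'s strategy, after every move of $\mathcal{B}$ made during the game $(K_n,P_2)$ (i.e., as long as the game has not ended), the red subgraph and the blue subgraph are isomorphic.
   Context: All graphs are finite simple graphs; $K_n$ is the complete graph on $n$ vertices and $P_2$ is the path with 2 edges. Given a graph $G$, two players $\mathcal{A}$ and $\mathcal{B}$ alternately color edges of $G$, $\mathcal{A}$ in red and $\mathcal{B}$ in blue, with $\mathcal{A}$ moving first; in each move a player colors one so-far uncolored edge. A strategy for a player is a function assigning to each sequence of the opponent's previous moves an uncolored edge to color next. For a graph $F$ that is a subgraph of $G$, the avoidance game $(G,F)$ is played this way with the ending condition that the player who first creates a monochromatic subgraph of $G$ isomorphic to $F$ loses (and the game ends). The red (resp. blue) subgraph is the subgraph formed by the red (resp. blue) edges. -}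

module Defs where

open import Data.Nat using (ℕ)
open import Data.Fin using (Fin) renaming (_<_ to _<ᶠ_)
open import Data.List using (List; []; _∷ʳ_; _++_)
open import Data.List.Membership.Propositional using (_∈_; _∉_)
open import Data.Product using (Σ; ∃; ∃-syntax; _×_)
open import Data.Sum using (_⊎_)
open import Relation.Binary.PropositionalEquality using (_≡_; _≢_)
open import Relation.Nullary using (¬_)
open import Function.Bundles using (_↔_; _⇔_; Inverse)

-- An edge of K_n on vertex set Fin n: an unordered pair {u,v}, u ≠ v,
-- represented canonically with u < v.
record Edge (n : ℕ) : Set where
  constructor edge
  field
    u : Fin n
    v : Fin n
    u<v : u <ᶠ v

open Edge public

Adj : {n : ℕ} → List (Edge n) → Fin n → Fin n → Set
Adj {n} E a b =
  Σ (Edge n) λ e → (e ∈ E) × ((u e ≡ a × v e ≡ b) ⊎ (u e ≡ b × v e ≡ a))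

HasP2 : {n : ℕ} → List (Edge n) → Set
HasP2 E = ∃[ a ] ∃[ b ] ∃[ c ] (a ≢ c × Adj E a b × Adj E b c)

Isomorphic : {n : ℕ} → List (Edge n) → List (Edge n) → Set
Isomorphic {n} E F =
  Σ (Fin n ↔ Fin n) λ σ →
    ∀ a b → Adj E a b ⇔ Adj F (Inverse.to σ a) (Inverse.to σ b)

-- A strategy maps the (chronological) list of the opponent's previous
-- moves to the edge to be colored next.
Strategy : ℕ → Set
Strategy n = List (Edge n) → Edge n

-- Reach sA sB R B : after some number of full rounds (A moves, then B moves)
-- of the avoidance game (K_n , P_2) played by A with sA and B with sB,
-- the red moves so far are R and the blue moves are B (chronologically),
-- all moves were legal (uncolored edges) and the game has not ended
-- (no monochromatic P_2 was created).
data Reach {n : ℕ} (sA sB : Strategy n) : List (Edge n) → List (Edge n) → Set where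
  start : Reach sA sB [] []
  step  : ∀ {R B} → Reach sA sB R B →
          sA B ∉ R ++ B →
          ¬ HasP2 (R ∷ʳ sA B) →
          sB (R ∷ʳ sA B) ∉ (R ∷ʳ sA B) ++ B →
          ¬ HasP2 (B ∷ʳ sB (R ∷ʳ sA B)) →
          Reach sA sB (R ∷ʳ sA B) (B ∷ʳ sB (R ∷ʳ sA B))

module Submission where

-- Both colour classes are matchings: red because a red P₂ ends the game, blue by
-- construction.  After each blue move three properties hold: some permutation σ
-- maps red onto blue, every red edge has a blue-covered endpoint, and unless blue
-- is empty some blue-free vertex is covered by red.  When red adds xy, blue joins
-- two blue-free vertices: if xy already meets blue, the two are chosen so as to
-- leave a red-covered vertex blue-free (or to cover everything); otherwise blue
-- joins x to a third blue-free vertex.  The last two properties guarantee that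
-- such a reply is never the red edge xy itself, and σ extends to the new edges by
-- composing it with two transpositions.

open import Defs
open import Data.Nat using (ℕ; _+_; _≤_; suc; s≤s; z≤n)
open import Data.Fin using (Fin; zero; suc) renaming (_<_ to _<ᶠ_)
open import Data.Fin.Properties using (_≟_; _<?_; any?; all?; <-irrelevant; <-asym; <-cmp; <⇒≢)
open import Data.Fin.Permutation using (Permutation′; _⟨$⟩ʳ_; _⟨$⟩ˡ_; inverseʳ; _∘ₚ_; transpose; id)
import Data.Fin.Permutation.Components as PC
open import Data.List using (List; []; _∷_; _∷ʳ_; _++_; foldl)
open import Data.List.Properties using (foldl-∷ʳ)
open import Data.List.Membership.Propositional using (_∈_; _∉_)
open import Data.List.Membership.Propositional.Properties using (∈-++⁺ˡ; ∈-++⁺ʳ; ∈-++⁻)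
open import Data.List.Relation.Unary.Any using (here; there)
open import Data.Product using (_×_; ∃-syntax; Σ; _,_; proj₁)
open import Data.Sum using (_⊎_; inj₁; inj₂; [_,_])
open import Data.Empty using (⊥-elim)
open import Function using (_∘_)
open import Function.Bundles using (_⇔_; Injection; Equivalence; mk⇔)
open import Function.Properties.Inverse using (↔⇒↣)
open import Relation.Nullary using (¬_; Dec; yes; no)
open import Relation.Nullary.Decidable using (_×-dec_; _⊎-dec_; _→-dec_; ¬?; dec-true; dec-false)
open import Relation.Binary.PropositionalEquality
  using (_≡_; _≢_; refl; sym; trans; cong; cong₂; subst; subst₂)
open import Relation.Binary.Definitions using (tri<; tri≈; tri>)

module _ {n : ℕ} where

  private variable
    E R B : List (Edge n)
    a b e : Edge n
    c d p q s t w x y z : Fin n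
    σ τ : Permutation′ n

  Joins : Edge n → Fin n → Fin n → Set
  Joins e a b = (u e ≡ a × v e ≡ b) ⊎ (u e ≡ b × v e ≡ a)

  Covered : List (Edge n) → Fin n → Set
  Covered E x = ∃[ w ] Adj E x w

  u≢v : (e : Edge n) → u e ≢ v e
  u≢v e = <⇒≢ (u<v e)

  joins-sym : Joins e p q → Joins e q p
  joins-sym (inj₁ p) = inj₂ p
  joins-sym (inj₂ p) = inj₁ p

  joins? : (e : Edge n) (a b : Fin n) → Dec (Joins e a b)
  joins? e a b = ((u e ≟ a) ×-dec (v e ≟ b)) ⊎-dec ((u e ≟ b) ×-dec (v e ≟ a))

  edgeBetween : p ≢ q → ∃[ b ] Joins b p q
  edgeBetween {p} {q} p≢q with <-cmp p q
  ... | tri< p<q _ _ = edge p q p<q , inj₁ (refl , refl)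
  ... | tri≈ _ p≡q _ = ⊥-elim (p≢q p≡q)
  ... | tri> _ _ q<p = edge q p q<p , inj₂ (refl , refl)

  adj-sym : Adj E p q → Adj E q p
  adj-sym (f , f∈ , j) = f , f∈ , joins-sym {e = f} j

  adj-∷ʳ⁺ˡ : Adj E p q → Adj (E ∷ʳ e) p q
  adj-∷ʳ⁺ˡ (f , f∈ , j) = f , ∈-++⁺ˡ f∈ , j

  adj-∷ʳ⁺ʳ : Joins e p q → Adj (E ∷ʳ e) p q
  adj-∷ʳ⁺ʳ {e = e} {E = E} j = e , ∈-++⁺ʳ E (here refl) , j

  adj-∷ʳ⁻ : Adj (E ∷ʳ e) p q → Adj E p q ⊎ Joins e p q
  adj-∷ʳ⁻ {E = E} (f , f∈ , j) with ∈-++⁻ E f∈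
  ... | inj₁ f∈E         = inj₁ (f , f∈E , j)
  ... | inj₂ (here refl) = inj₂ j

  adj? : (E : List (Edge n)) (a b : Fin n) → Dec (Adj E a b)
  adj? [] a b = no λ { (_ , () , _) }
  adj? (e ∷ E) a b with joins? e a b | adj? E a b
  ... | yes j | _                 = yes (e , here refl , j)
  ... | no _  | yes (f , f∈ , j)  = yes (f , there f∈ , j)
  ... | no ¬j | no ¬adj           = no λ where
    (f , here refl , j) → ¬j j
    (f , there f∈ , j)  → ¬adj (f , f∈ , j)

  ∈⇒adj : e ∈ E → Adj E (u e) (v e)
  ∈⇒adj {e = e} e∈ = e , e∈ , inj₁ (refl , refl)

  adj⇒∈ : Adj E (u e) (v e) → e ∈ E
  adj⇒∈ {E} {edge a b a<b} (edge .a .b a<b′ , f∈ , inj₁ (refl , refl)) =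
    subst (λ lt → edge a b lt ∈ E) (<-irrelevant a<b′ a<b) f∈
  adj⇒∈ {e = e} (f , _ , inj₂ (refl , refl)) = ⊥-elim (<-asym (u<v e) (u<v f))

  covered? : (E : List (Edge n)) (x : Fin n) → Dec (Covered E x)
  covered? E x = any? (adj? E x)

  covered-∷ʳ⁺ˡ : Covered E x → Covered (E ∷ʳ e) x
  covered-∷ʳ⁺ˡ (w , adj) = w , adj-∷ʳ⁺ˡ adj

  joins⇒coveredˡ : Joins e p q → Covered (E ∷ʳ e) p
  joins⇒coveredˡ {q = q} j = q , adj-∷ʳ⁺ʳ j

  joins⇒coveredʳ : Joins e p q → Covered (E ∷ʳ e) q
  joins⇒coveredʳ {e = e} j = joins⇒coveredˡ (joins-sym {e = e} j)

  covered-∷ʳ⁻ : Joins e p q → Covered (E ∷ʳ e) x → Covered E x ⊎ x ≡ p ⊎ x ≡ q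
  covered-∷ʳ⁻ j (w , adj) with adj-∷ʳ⁻ adj | j
  ... | inj₁ adjE                  | _                  = inj₁ (w , adjE)
  ... | inj₂ (inj₁ (refl , _))     | inj₁ (ux≡p , _)    = inj₂ (inj₁ ux≡p)
  ... | inj₂ (inj₁ (refl , _))     | inj₂ (ux≡q , _)    = inj₂ (inj₂ ux≡q)
  ... | inj₂ (inj₂ (_ , refl))     | inj₁ (_ , vx≡q)    = inj₂ (inj₂ vx≡q)
  ... | inj₂ (inj₂ (_ , refl))     | inj₂ (_ , vx≡p)    = inj₂ (inj₁ vx≡p)

  uncovered-∷ʳ : Joins e p q → ¬ Covered E x → x ≢ p → x ≢ q → ¬ Covered (E ∷ʳ e) x
  uncovered-∷ʳ j ¬cov x≢p x≢q cov with covered-∷ʳ⁻ j cov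
  ... | inj₁ covE         = ¬cov covE
  ... | inj₂ (inj₁ x≡p)   = x≢p x≡p
  ... | inj₂ (inj₂ x≡q)   = x≢q x≡q

  endpoints-uncovered : a ∉ R → ¬ HasP2 (R ∷ʳ a) →
                        ¬ Covered R (u a) × ¬ Covered R (v a)
  endpoints-uncovered {a = a} {R = R} a∉R noP2 = ¬covᵘ , ¬covᵛ
    where
    ¬covᵘ : ¬ Covered R (u a)
    ¬covᵘ (w , adj) with w ≟ v a
    ... | yes refl = a∉R (adj⇒∈ adj)
    ... | no w≢v   = noP2 (w , u a , v a , w≢v , adj-sym (adj-∷ʳ⁺ˡ adj) ,
                           adj-∷ʳ⁺ʳ (inj₁ (refl , refl)))
    ¬covᵛ : ¬ Covered R (v a)
    ¬covᵛ (w , adj) with w ≟ u a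
    ... | yes refl = a∉R (adj⇒∈ (adj-sym adj))
    ... | no w≢u   = noP2 (w , v a , u a , w≢u , adj-sym (adj-∷ʳ⁺ˡ adj) ,
                           adj-∷ʳ⁺ʳ (inj₂ (refl , refl)))

  transpose-hit : (i j : Fin n) → PC.transpose i j i ≡ j
  transpose-hit i j rewrite dec-true (i ≟ i) refl = refl

  transpose-miss : (i j : Fin n) → x ≢ i → x ≢ j → PC.transpose i j x ≡ x
  transpose-miss {x = x} i j x≢i x≢j
    rewrite dec-false (x ≟ i) x≢i | dec-false (x ≟ j) x≢j = refl

  ⟨$⟩ʳ-injective : (σ : Permutation′ n) → σ ⟨$⟩ʳ x ≡ σ ⟨$⟩ʳ y → x ≡ y
  ⟨$⟩ʳ-injective σ = Injection.injective (↔⇒↣ σ)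

  redirect : Permutation′ n → Fin n → Fin n → Permutation′ n
  redirect σ x p = σ ∘ₚ transpose (σ ⟨$⟩ʳ x) p

  redirect-hit : (σ : Permutation′ n) → redirect σ x p ⟨$⟩ʳ x ≡ p
  redirect-hit {x = x} {p = p} σ = transpose-hit (σ ⟨$⟩ʳ x) p

  redirect-miss : (σ : Permutation′ n) → z ≢ x → σ ⟨$⟩ʳ z ≢ p →
                  redirect σ x p ⟨$⟩ʳ z ≡ σ ⟨$⟩ʳ z
  redirect-miss {x = x} {p = p} σ z≢x σz≢p =
    transpose-miss (σ ⟨$⟩ʳ x) p (z≢x ∘ ⟨$⟩ʳ-injective σ) σz≢p

  relabel : (σ : Permutation′ n) → x ≢ y → p ≢ q →
            ∃[ τ ] (τ ⟨$⟩ʳ x ≡ p × τ ⟨$⟩ʳ y ≡ q ×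
                    (∀ z → z ≢ x → z ≢ y → σ ⟨$⟩ʳ z ≢ p → σ ⟨$⟩ʳ z ≢ q → τ ⟨$⟩ʳ z ≡ σ ⟨$⟩ʳ z))
  relabel {x = x} {y = y} {p = p} {q = q} σ x≢y p≢q =
    redirect σ₁ y q , τx≡p , redirect-hit σ₁ , agree
    where
    σ₁ = redirect σ x p
    τx≡p : redirect σ₁ y q ⟨$⟩ʳ x ≡ p
    τx≡p = trans (redirect-miss σ₁ x≢y (λ σ₁x≡q → p≢q (trans (sym (redirect-hit σ)) σ₁x≡q)))
                 (redirect-hit σ)
    agree : ∀ z → z ≢ x → z ≢ y → σ ⟨$⟩ʳ z ≢ p → σ ⟨$⟩ʳ z ≢ q →
            redirect σ₁ y q ⟨$⟩ʳ z ≡ σ ⟨$⟩ʳ z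
    agree z z≢x z≢y σz≢p σz≢q = trans (redirect-miss σ₁ z≢y σ₁z≢q) σ₁z≡σz
      where
      σ₁z≡σz = redirect-miss σ z≢x σz≢p
      σ₁z≢q = λ σ₁z≡q → σz≢q (trans (sym σ₁z≡σz) σ₁z≡q)

  IsomorphismVia : Permutation′ n → List (Edge n) → List (Edge n) → Set
  IsomorphismVia σ E F = ∀ s t → Adj E s t ⇔ Adj F (σ ⟨$⟩ʳ s) (σ ⟨$⟩ʳ t)

  covered-via : IsomorphismVia σ R B → Covered R z → Covered B (σ ⟨$⟩ʳ z)
  covered-via {σ = σ} {z = z} iso (w , adj) = σ ⟨$⟩ʳ w , Equivalence.to (iso z w) adj

  covered-via⁻ : IsomorphismVia σ R B → Covered B (σ ⟨$⟩ʳ z) → Covered R z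
  covered-via⁻ {σ = σ} {B = B} {z = z} iso (w , adj) =
    σ ⟨$⟩ˡ w ,
    Equivalence.from (iso z (σ ⟨$⟩ˡ w)) (subst (Adj B (σ ⟨$⟩ʳ z)) (sym (inverseʳ σ)) adj)

  isomorphismVia-∷ʳ : IsomorphismVia σ R B →
                      (∀ z → Covered R z → τ ⟨$⟩ʳ z ≡ σ ⟨$⟩ʳ z) →
                      τ ⟨$⟩ʳ u a ≡ u b → τ ⟨$⟩ʳ v a ≡ v b →
                      IsomorphismVia τ (R ∷ʳ a) (B ∷ʳ b)
  isomorphismVia-∷ʳ {σ = σ} {R = R} {B = B} {τ = τ} {a = a} {b = b} iso agree τu τv s t =
    mk⇔ forth back
    where
    covered-back : Covered B (τ ⟨$⟩ʳ z) → Covered R z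
    covered-back {z = z} cov = subst (Covered R) c≡z covc
      where
      covc = covered-via⁻ {σ = σ} iso (subst (Covered B) (sym (inverseʳ σ)) cov)
      c≡z = ⟨$⟩ʳ-injective τ (trans (agree _ covc) (inverseʳ σ))

    joins-forth : Joins a x y → Joins b (τ ⟨$⟩ʳ x) (τ ⟨$⟩ʳ y)
    joins-forth (inj₁ (refl , refl)) = inj₁ (sym τu , sym τv)
    joins-forth (inj₂ (refl , refl)) = inj₂ (sym τu , sym τv)

    joins-back : Joins b (τ ⟨$⟩ʳ x) (τ ⟨$⟩ʳ y) → Joins a x y
    joins-back (inj₁ (ub≡ , vb≡)) =
      inj₁ (⟨$⟩ʳ-injective τ (trans τu ub≡) , ⟨$⟩ʳ-injective τ (trans τv vb≡))
    joins-back (inj₂ (ub≡ , vb≡)) =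
      inj₂ (⟨$⟩ʳ-injective τ (trans τu ub≡) , ⟨$⟩ʳ-injective τ (trans τv vb≡))

    forth : Adj (R ∷ʳ a) s t → Adj (B ∷ʳ b) (τ ⟨$⟩ʳ s) (τ ⟨$⟩ʳ t)
    forth adj with adj-∷ʳ⁻ adj
    ... | inj₂ j    = adj-∷ʳ⁺ʳ (joins-forth j)
    ... | inj₁ adjR = adj-∷ʳ⁺ˡ (subst₂ (Adj B) (sym (agree s (t , adjR)))
                                              (sym (agree t (s , adj-sym adjR)))
                                       (Equivalence.to (iso s t) adjR))

    back : Adj (B ∷ʳ b) (τ ⟨$⟩ʳ s) (τ ⟨$⟩ʳ t) → Adj (R ∷ʳ a) s t
    back adj with adj-∷ʳ⁻ adj
    ... | inj₂ j    = adj-∷ʳ⁺ʳ (joins-back j)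
    ... | inj₁ adjB = adj-∷ʳ⁺ˡ (Equivalence.from (iso s t)
                        (subst₂ (Adj B) (agree s (covered-back (_ , adjB)))
                                        (agree t (covered-back (_ , adj-sym adjB))) adjB))

  isomorphic-∷ʳ : Isomorphic R B → ¬ Covered R (u a) → ¬ Covered R (v a) →
                  ¬ Covered B (u b) → ¬ Covered B (v b) → Isomorphic (R ∷ʳ a) (B ∷ʳ b)
  isomorphic-∷ʳ {R = R} {B = B} {a = a} {b = b} (σ , iso) ¬covᵘ ¬covᵛ ¬covᵘ′ ¬covᵛ′
    with relabel σ (u≢v a) (u≢v b)
  ... | τ , τu , τv , agree =
    τ , isomorphismVia-∷ʳ {σ = σ} {R = R} {B = B} {τ = τ} {a = a} {b = b} iso agreeᴿ τu τv
    where
    agreeᴿ : ∀ z → Covered R z → τ ⟨$⟩ʳ z ≡ σ ⟨$⟩ʳ z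
    agreeᴿ z cov = agree z (λ { refl → ¬covᵘ cov }) (λ { refl → ¬covᵛ cov })
      (λ σz≡ → ¬covᵘ′ (subst (Covered B) σz≡ (covered-via {σ = σ} iso cov)))
      (λ σz≡ → ¬covᵛ′ (subst (Covered B) σz≡ (covered-via {σ = σ} iso cov)))

  Meets : List (Edge n) → List (Edge n) → Set
  Meets R B = ∀ s t → Adj R s t → Covered B s ⊎ Covered B t

  Spare : List (Edge n) → List (Edge n) → Set
  Spare R B = (∃[ w ] ¬ Covered B w) → ∃[ c ] (¬ Covered B c × Covered R c)

  Invariant : List (Edge n) → List (Edge n) → Set
  Invariant R B = Isomorphic R B × Meets R B × (Spare R B ⊎ (∀ w → ¬ Covered B w))

  GoodReply : List (Edge n) → List (Edge n) → Edge n → Edge n → Set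
  GoodReply R B a b =
    ¬ Covered B (u b) × ¬ Covered B (v b) × ¬ Adj (R ∷ʳ a) (u b) (v b) ×
    Meets (R ∷ʳ a) (B ∷ʳ b) × Spare (R ∷ʳ a) (B ∷ʳ b)

  meets? : (R B : List (Edge n)) → Dec (Meets R B)
  meets? R B = all? λ s → all? λ t → adj? R s t →-dec (covered? B s ⊎-dec covered? B t)

  spare? : (R B : List (Edge n)) → Dec (Spare R B)
  spare? R B = any? (¬? ∘ covered? B) →-dec any? λ c → ¬? (covered? B c) ×-dec covered? R c

  goodReply? : (R B : List (Edge n)) (a b : Edge n) → Dec (GoodReply R B a b)
  goodReply? R B a b =
    ¬? (covered? B (u b)) ×-dec ¬? (covered? B (v b)) ×-dec ¬? (adj? (R ∷ʳ a) (u b) (v b)) ×-dec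
    meets? (R ∷ʳ a) (B ∷ʳ b) ×-dec spare? (R ∷ʳ a) (B ∷ʳ b)

  goodReply-between? : (R B : List (Edge n)) (a : Edge n) (p q : Fin n) →
                       Dec (Σ (p <ᶠ q) λ p<q → GoodReply R B a (edge p q p<q))
  goodReply-between? R B a p q with p <? q
  ... | no p≮q = no (p≮q ∘ proj₁)
  ... | yes p<q with goodReply? R B a (edge p q p<q)
  ...   | yes good = yes (p<q , good)
  ...   | no ¬good = no λ (p<q′ , good) →
          ¬good (subst (λ lt → GoodReply R B a (edge p q lt)) (<-irrelevant p<q′ p<q) good)

  searchReply : (R B : List (Edge n)) (a : Edge n) →
                Dec (∃[ p ] ∃[ q ] Σ (p <ᶠ q) λ p<q → GoodReply R B a (edge p q p<q))
  searchReply R B a = any? λ p → any? λ q → goodReply-between? R B a p q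

  respond : List (Edge n) → List (Edge n) → Edge n → Edge n
  respond R B a with searchReply R B a
  ... | yes (p , q , p<q , _) = edge p q p<q
  ... | no _                  = a

  respond-good : ∃[ b ] GoodReply R B a b → GoodReply R B a (respond R B a)
  respond-good {R = R} {B = B} {a = a} (b , good) with searchReply R B a
  ... | yes (_ , _ , _ , good′) = good′
  ... | no none                 = ⊥-elim (none (u b , v b , u<v b , good))

  meets-∷ʳ⁺ʳ : Meets R B → Meets R (B ∷ʳ b)
  meets-∷ʳ⁺ʳ meets s t adj = [ inj₁ ∘ covered-∷ʳ⁺ˡ , inj₂ ∘ covered-∷ʳ⁺ˡ ] (meets s t adj)

  meets-∷ʳ⁺ˡ : Meets R B → Covered B (u a) ⊎ Covered B (v a) → Meets (R ∷ʳ a) B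
  meets-∷ʳ⁺ˡ meets hit s t adj with adj-∷ʳ⁻ adj
  ... | inj₁ adjR                 = meets s t adjR
  ... | inj₂ (inj₁ (refl , refl)) = hit
  ... | inj₂ (inj₂ (refl , refl)) = [ inj₂ , inj₁ ] hit

  goodReply-joins : Joins b p q → ¬ Covered B p → ¬ Covered B q → ¬ Adj (R ∷ʳ a) p q →
                    Meets (R ∷ʳ a) (B ∷ʳ b) → Spare (R ∷ʳ a) (B ∷ʳ b) → GoodReply R B a b
  goodReply-joins (inj₁ (refl , refl)) ¬covp ¬covq ¬adj meets spare =
    ¬covp , ¬covq , ¬adj , meets , spare
  goodReply-joins (inj₂ (refl , refl)) ¬covp ¬covq ¬adj meets spare =
    ¬covq , ¬covp , ¬adj ∘ adj-sym , meets , spare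

  goodReply-uncovered : Meets (R ∷ʳ a) B → Joins b p q → ¬ Covered B p → ¬ Covered B q →
                        Spare (R ∷ʳ a) (B ∷ʳ b) → GoodReply R B a b
  goodReply-uncovered {p = p} {q = q} meets j ¬covp ¬covq =
    goodReply-joins j ¬covp ¬covq (λ adj → [ ¬covp , ¬covq ] (meets p q adj)) (meets-∷ʳ⁺ʳ meets)

  goodReply-avoiding : Meets (R ∷ʳ a) B → ¬ Covered B c → Covered R c → ¬ Covered B d → d ≢ c →
                       ∃[ b ] GoodReply R B a b
  goodReply-avoiding {R = R} {a = a} {B = B} {c = c} {d = d} meets ¬Bc Rc ¬Bd d≢c
    with any? (λ e → ¬? (covered? B e) ×-dec ¬? (e ≟ c) ×-dec ¬? (e ≟ d))
  ... | yes (e , ¬Be , e≢c , e≢d) = keepingSpare (edgeBetween (e≢d ∘ sym))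
    where
    keepingSpare : ∃[ b ] Joins b d e → ∃[ b ] GoodReply R B a b
    keepingSpare (b , j) = b , goodReply-uncovered meets j ¬Bd ¬Be
      λ _ → c , uncovered-∷ʳ j ¬Bc (d≢c ∘ sym) (e≢c ∘ sym) , covered-∷ʳ⁺ˡ Rc
  ... | no none = coveringAll (edgeBetween (d≢c ∘ sym))
    where
    coveringAll : ∃[ b ] Joins b c d → ∃[ b ] GoodReply R B a b
    coveringAll (b , j) = b , goodReply-uncovered meets j ¬Bc ¬Bd λ (w , ¬Bw) →
      ⊥-elim (none (w , ¬Bw ∘ covered-∷ʳ⁺ˡ , (λ { refl → ¬Bw (joins⇒coveredˡ j) })
                                           , (λ { refl → ¬Bw (joins⇒coveredʳ j) })))

  goodReply-meeting : Invariant R B → ¬ Covered R (u a) → ¬ Covered R (v a) →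
                      Covered B (u a) ⊎ Covered B (v a) → ∃[ b ] GoodReply R B a b
  goodReply-meeting {R = R} {B = B} {a = a} ((σ , iso) , meets , spare) ¬Rᵘ ¬Rᵛ hit =
    avoid redSpare
    where
    ¬B∘σ : ¬ Covered R z → ¬ Covered B (σ ⟨$⟩ʳ z)
    ¬B∘σ ¬R = ¬R ∘ covered-via⁻ {σ = σ} iso

    redSpare : ∃[ c ] (¬ Covered B c × Covered R c)
    redSpare = [ (λ spare′ → spare′ (σ ⟨$⟩ʳ u a , ¬B∘σ ¬Rᵘ))
               , (λ none → ⊥-elim ([ none _ , none _ ] hit)) ] spare

    avoid : ∃[ c ] (¬ Covered B c × Covered R c) → ∃[ b ] GoodReply R B a b
    avoid (c , ¬Bc , Rc) with σ ⟨$⟩ʳ u a ≟ c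
    ... | no σu≢c  = goodReply-avoiding (meets-∷ʳ⁺ˡ meets hit) ¬Bc Rc (¬B∘σ ¬Rᵘ) σu≢c
    ... | yes σu≡c = goodReply-avoiding (meets-∷ʳ⁺ˡ meets hit) ¬Bc Rc (¬B∘σ ¬Rᵛ)
                       (λ σv≡c → u≢v a (⟨$⟩ʳ-injective σ (trans σu≡c (sym σv≡c))))

  record Replay : Set where
    field
      red blue : List (Edge n)
      lastReply : Edge n

  open Replay

  replay-step : Replay → Edge n → Replay
  replay-step r a = record
    { red = red r ∷ʳ a ; blue = blue r ∷ʳ reply ; lastReply = reply }
    where reply = respond (red r) (blue r) a

  -- e₀ only answers the empty history, which never occurs in a game.
  replay : Edge n → List (Edge n) → Replay
  replay e₀ = foldl replay-step (record { red = [] ; blue = [] ; lastReply = e₀ })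

  strategy : Edge n → Strategy n
  strategy e₀ = lastReply ∘ replay e₀

  replay-∷ʳ : ∀ e₀ R a → replay e₀ (R ∷ʳ a) ≡ replay-step (replay e₀ R) a
  replay-∷ʳ e₀ R a = foldl-∷ʳ replay-step _ a R

  strategy-∷ʳ : ∀ e₀ → red (replay e₀ R) ≡ R → blue (replay e₀ R) ≡ B →
                strategy e₀ (R ∷ʳ a) ≡ respond R B a
  strategy-∷ʳ {R = R} {B = B} {a = a} e₀ redR blueB =
    trans (cong lastReply (replay-∷ʳ e₀ R a)) (cong₂ (λ R′ B′ → respond R′ B′ a) redR blueB)

  replay-reach : ∀ {e₀ sA} → Reach sA (strategy e₀) R B →
                 red (replay e₀ R) ≡ R × blue (replay e₀ R) ≡ B
  replay-reach start = refl , refl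
  replay-reach {e₀ = e₀} {sA = sA} (step {R} {B} reach _ _ _ _) with replay-reach reach
  ... | redR , blueB =
    trans (cong red unfold) (cong (_∷ʳ sA B) redR) ,
    trans (cong blue unfold) (cong₂ _∷ʳ_ blueB (sym (cong lastReply unfold)))
    where unfold = replay-∷ʳ e₀ R (sA B)

  module _ (third : (x y : Fin n) → ∃[ w ] (w ≢ x × w ≢ y)) where

    goodReply-fresh : Invariant R B → ¬ Covered R (u a) → ¬ Covered R (v a) →
                      ¬ Covered B (u a) → ¬ Covered B (v a) → ∃[ b ] GoodReply R B a b
    goodReply-fresh {R = R} {B = B} {a = a} (_ , meets , spare) ¬Rᵘ ¬Rᵛ ¬Bᵘ ¬Bᵛ = reply blueFree
      where
      blueFree : ∃[ w ] (w ≢ u a × w ≢ v a × ¬ Covered B w)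
      blueFree = [ redSpare , anyThird ] spare
        where
        redSpare : Spare R B → ∃[ w ] (w ≢ u a × w ≢ v a × ¬ Covered B w)
        redSpare spare′ with spare′ (u a , ¬Bᵘ)
        ... | c , ¬Bc , Rc = c , (λ { refl → ¬Rᵘ Rc }) , (λ { refl → ¬Rᵛ Rc }) , ¬Bc

        anyThird : (∀ w → ¬ Covered B w) → ∃[ w ] (w ≢ u a × w ≢ v a × ¬ Covered B w)
        anyThird none = let w , w≢u , w≢v = third (u a) (v a) in w , w≢u , w≢v , none w

      reply : ∃[ w ] (w ≢ u a × w ≢ v a × ¬ Covered B w) → ∃[ b ] GoodReply R B a b
      reply (w , w≢u , w≢v , ¬Bw) with edgeBetween (w≢u ∘ sym)
      ... | b , j = b , goodReply-joins j ¬Bᵘ ¬Bw ¬adj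
                          (meets-∷ʳ⁺ˡ (meets-∷ʳ⁺ʳ meets) (inj₁ (joins⇒coveredˡ j))) spare′
        where
        ¬adj : ¬ Adj (R ∷ʳ a) (u a) w
        ¬adj adj with adj-∷ʳ⁻ adj
        ... | inj₁ adjR             = ¬Rᵘ (w , adjR)
        ... | inj₂ (inj₁ (_ , v≡w)) = w≢v (sym v≡w)
        ... | inj₂ (inj₂ (u≡w , _)) = w≢u (sym u≡w)

        spare′ : Spare (R ∷ʳ a) (B ∷ʳ b)
        spare′ _ = v a , uncovered-∷ʳ j ¬Bᵛ (u≢v a ∘ sym) (w≢v ∘ sym)
                       , u a , adj-∷ʳ⁺ʳ (inj₂ (refl , refl))

    goodReply-exists : Invariant R B → ¬ Covered R (u a) → ¬ Covered R (v a) →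
                       ∃[ b ] GoodReply R B a b
    goodReply-exists {R = R} {B = B} {a = a} inv ¬Rᵘ ¬Rᵛ
      with covered? B (u a) | covered? B (v a)
    ... | yes Bᵘ | _      = goodReply-meeting inv ¬Rᵘ ¬Rᵛ (inj₁ Bᵘ)
    ... | no _   | yes Bᵛ = goodReply-meeting inv ¬Rᵘ ¬Rᵛ (inj₂ Bᵛ)
    ... | no ¬Bᵘ | no ¬Bᵛ = goodReply-fresh inv ¬Rᵘ ¬Rᵛ ¬Bᵘ ¬Bᵛ

    invariant-step : Invariant R B → a ∉ R → ¬ HasP2 (R ∷ʳ a) →
                     Invariant (R ∷ʳ a) (B ∷ʳ respond R B a) × respond R B a ∉ (R ∷ʳ a) ++ B
    invariant-step {R = R} {B = B} {a = a} inv a∉R noP2 with endpoints-uncovered a∉R noP2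
    ... | ¬Rᵘ , ¬Rᵛ with respond-good (goodReply-exists inv ¬Rᵘ ¬Rᵛ)
    ... | ¬Bᵘ , ¬Bᵛ , ¬adj , meets , spare =
      (isomorphic-∷ʳ (proj₁ inv) ¬Rᵘ ¬Rᵛ ¬Bᵘ ¬Bᵛ , meets , inj₁ spare) , legal
      where
      legal : respond R B a ∉ (R ∷ʳ a) ++ B
      legal b∈ with ∈-++⁻ (R ∷ʳ a) b∈
      ... | inj₁ b∈R = ¬adj (∈⇒adj b∈R)
      ... | inj₂ b∈B = ¬Bᵘ (_ , ∈⇒adj b∈B)

    strategy-step : ∀ {e₀ sA} → Reach sA (strategy e₀) R B → Invariant R B →
                    sA B ∉ R → ¬ HasP2 (R ∷ʳ sA B) →
                    let b = strategy e₀ (R ∷ʳ sA B) in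
                    Invariant (R ∷ʳ sA B) (B ∷ʳ b) × b ∉ (R ∷ʳ sA B) ++ B
    strategy-step {R = R} {B = B} {e₀ = e₀} {sA = sA} reach inv a∉R noP2
      with replay-reach reach
    ... | redR , blueB rewrite strategy-∷ʳ {a = sA B} e₀ redR blueB =
      invariant-step inv a∉R noP2

    reach-invariant : ∀ {e₀ sA} → Reach sA (strategy e₀) R B → Invariant R B
    reach-invariant start = (id , λ _ _ → mk⇔ (λ ()) (λ ())) , (λ _ _ ()) , inj₂ (λ _ ())
    reach-invariant (step reach a∉ noP2 _ _) =
      proj₁ (strategy-step reach (reach-invariant reach) (a∉ ∘ ∈-++⁺ˡ) noP2)

third-vertex : ∀ {m} (x y : Fin (3 + m)) → ∃[ w ] (w ≢ x × w ≢ y)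
third-vertex zero          zero          = suc zero , (λ ()) , (λ ())
third-vertex zero          (suc zero)    = suc (suc zero) , (λ ()) , (λ ())
third-vertex zero          (suc (suc _)) = suc zero , (λ ()) , (λ ())
third-vertex (suc zero)    zero          = suc (suc zero) , (λ ()) , (λ ())
third-vertex (suc (suc _)) zero          = suc zero , (λ ()) , (λ ())
third-vertex (suc _)       (suc _)       = zero , (λ ()) , (λ ())

theorem6 : (n : ℕ) → 3 ≤ n →
    ∃[ sB ] ((sA : Strategy n) → ∀ R B → Reach sA sB R B →
      sA B ∉ R ++ B →
      ¬ HasP2 (R ∷ʳ sA B) →
      (∃[ e ] (e ∉ (R ∷ʳ sA B) ++ B)) →
      (sB (R ∷ʳ sA B) ∉ (R ∷ʳ sA B) ++ B)
        × Isomorphic (R ∷ʳ sA B) (B ∷ʳ sB (R ∷ʳ sA B)))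
-- A good reply always exists.
theorem6 (suc (suc (suc m))) (s≤s (s≤s (s≤s _))) =
  strategy e₀ , λ sA R B reach a∉ noP2 _ →
    let inv , legal = strategy-step third-vertex reach (reach-invariant third-vertex reach)
                                    (a∉ ∘ ∈-++⁺ˡ) noP2
    in legal , proj₁ inv
  where
  e₀ : Edge (3 + m)
  e₀ = edge zero (suc zero) (s≤s z≤n)
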